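{- A graph is JIS if and only if its 2-core is JIS.
   Context: All graphs are finite and simple. The 2-core of a graph $G$ is the graph obtained from $G$ by recursively removing vertices of degree less than $2$ until no such vertices remain. A graph $G$ is called JIS if there exist a positive integer $n$ and an assignment of an $n$-element set $S_v$ to each vertex $v$ of $G$ such that distinct vertices receive distinct sets, and for distinct vertices $v,w$, $v$ and $w$ are adjacent iff $|S_v \cap S_w| = n-1$ (equivalently, $G$ is isomorphic to an induced subgraph of a Johnson graph). -}

module Defs where

open import Data.Nat using (ℕ; zero; suc; _∸_; _≤_; _≤ᵇ_)
open import Data.Bool using (Bool; true; false; _∧_; T)
open import Data.Fin using (Fin)
open import Data.Fin.Subset using (Subset; _∈_; _∩_; ∣_∣; ⊤; inside)
open import Data.Vec using (tabulate; lookup)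
open import Data.Product using (Σ; ∃; ∃-syntax; _×_)
open import Relation.Binary.PropositionalEquality using (_≡_; _≢_)
open import Relation.Nullary using (¬_)
open import Function.Bundles using (_⇔_)

record Graph (n : ℕ) : Set where
  field
    adj     : Fin n → Fin n → Bool
    sym     : ∀ u v → adj u v ≡ adj v u
    irrefl  : ∀ v → adj v v ≡ false
open Graph public

nbhd : ∀ {n} → Graph n → Fin n → Subset n
nbhd G v = tabulate (adj G v)

degIn : ∀ {n} → Graph n → Subset n → Fin n → ℕ
degIn G P v = ∣ P ∩ nbhd G v ∣

peel : ∀ {n} → Graph n → Subset n → Subset n
peel G P = tabulate (λ v → lookup P v ∧ (2 ≤ᵇ degIn G P v))

iter : ∀ {A : Set} → ℕ → (A → A) → A → A
iter zero    f x = x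
iter (suc k) f x = f (iter k f x)

-- Vertex set of the 2-core: start with all vertices and repeatedly delete
-- vertices of degree < 2.  Every round that is not a fixed point removes a
-- vertex, so n rounds reach the fixed point (the 2-core).
coreVertices : ∀ {n} → Graph n → Subset n
coreVertices {n} G = iter n (peel G) ⊤

JISOn : ∀ {n} → Graph n → Subset n → Set
JISOn {n} G P =
  ∃[ k ] ∃[ m ] Σ (Fin n → Subset m) λ S →
      (1 ≤ k)
    × (∀ v → v ∈ P → ∣ S v ∣ ≡ k)
    × (∀ v w → v ∈ P → w ∈ P → v ≢ w → S v ≢ S w)
    × (∀ v w → v ∈ P → w ∈ P → v ≢ w →
         (T (adj G v w) ⇔ (∣ S v ∩ S w ∣ ≡ k ∸ 1)))

JIS : ∀ {n} → Graph n → Set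
JIS G = JISOn G ⊤

CoreJIS : ∀ {n} → Graph n → Set
CoreJIS G = JISOn G (coreVertices G)

module Submission where

-- JIS is inherited by induced subgraphs, which gives one direction at once.
-- The other direction undoes the peeling that produces the 2-core.  The key
-- fact (`extend`) is: if G[Q] is JIS, witnessed by k-sets S, and v has at
-- most one neighbour in Q, then G[Q ∪ {v}] is JIS.  Pad every old set with
-- the two tag points {a,b}, so old adjacency is preserved; give v either the
-- set of its neighbour u padded with {b,c} (it then meets u's new set in
-- k + 1 points and any other old set in fewer), or, if v has no neighbour
-- in Q, k + 2 fresh points.  A vertex removed by one peeling round has at
-- most one neighbour in the current vertex set, so re-inserting the removed
-- vertices one at a time (`reinsert`) undoes a round (`unpeel`); undoing all
-- n rounds recovers the whole graph from its 2-core.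

open import Defs
open import Data.Nat using (ℕ; zero; suc; pred; _+_; _∸_; _≤_; z≤n; s≤s)
open import Data.Nat.Properties using (+-identityʳ; +-cancelˡ-≡; ≤-trans; <-irrefl; 0≢1+n; ≤⇒≤ᵇ)
open import Data.Bool using (Bool; true; false; _∧_; T)
open import Data.Bool.Properties using (T?; T-≡; T-∧)
open import Data.Fin using (Fin; _≟_)
open import Data.Fin.Subset using (Subset; _∈_; _∩_; _-_; ∣_∣; ⊤; ⊥)
open import Data.Fin.Subset.Properties
  using (_∈?_; ∈⊤; ∣⊤∣≡n; ∣⊥∣≡0; ∩-comm; ∩-idem; ∩-zeroˡ; ∣p∩q∣≤∣p∣; ∣p∩q∣≤∣q∣;
         x∈p∩q⁺; x∈p∧x≢y⇒x∈p-y; x∈p⇒∣p-x∣<∣p∣)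
open import Data.Fin.Properties using (any?)
open import Data.Vec using (_∷_; []; _++_; tabulate)
open import Data.Vec.Properties using (++-injectiveʳ; zipWith-++; []=⇒lookup; lookup⇒[]=; lookup∘tabulate)
open import Data.List using (List; []; _∷_; allFin)
open import Data.List.Relation.Unary.Any using (here; there)
open import Data.List.Membership.Propositional using () renaming (_∈_ to _∈ₗ_)
open import Data.List.Membership.Propositional.Properties using (∈-allFin)
open import Data.Product using (Σ; ∃-syntax; _×_; _,_; proj₁; proj₂)
open import Data.Sum using (_⊎_; inj₁; inj₂)
open import Data.Empty using (⊥-elim)
open import Relation.Binary.PropositionalEquality
  using (_≡_; _≢_; refl; trans; cong; cong₂; subst; module ≡-Reasoning) renaming (sym to ≡-sym)
open import Relation.Nullary using (¬_; yes; no)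
open import Relation.Nullary.Decidable using (_×-dec_; _⊎-dec_; decidable-stable)
open import Relation.Unary using (Decidable)
open import Function.Bundles using (_⇔_; mk⇔; Equivalence)

open Equivalence using (to; from)

private
  variable
    n m j : ℕ

Represents : Graph n → (Fin n → Set) → ℕ → (Fin n → Subset m) → Set
Represents G P k S =
    (∀ v → P v → ∣ S v ∣ ≡ k)
  × (∀ v w → P v → P w → v ≢ w → S v ≢ S w)
  × (∀ v w → P v → P w → v ≢ w → (T (adj G v w) ⇔ (∣ S v ∩ S w ∣ ≡ k ∸ 1)))

-- `JISOn` for a vertex set given by a predicate; `JISPred G (_∈ P)` is
-- literally `JISOn G P`.
JISPred : Graph n → (Fin n → Set) → Set
JISPred {n} G P = ∃[ k ] ∃[ m ] Σ (Fin n → Subset m) λ S → (1 ≤ k) × Represents G P k S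

JISPred-mono : ∀ (G : Graph n) {P Q : Fin n → Set} →
               (∀ {x} → Q x → P x) → JISPred G P → JISPred G Q
JISPred-mono _ Q⊆P (k , m , S , 1≤k , size , distinct , adjacent) =
  k , m , S , 1≤k , (λ v q → size v (Q⊆P q))
    , (λ v w qv qw → distinct v w (Q⊆P qv) (Q⊆P qw))
    , (λ v w qv qw → adjacent v w (Q⊆P qv) (Q⊆P qw))

∣++∣ : (s : Subset j) (p : Subset m) → ∣ s ++ p ∣ ≡ ∣ s ∣ + ∣ p ∣
∣++∣ []          p = refl
∣++∣ (true ∷ s)  p = cong suc (∣++∣ s p)
∣++∣ (false ∷ s) p = ∣++∣ s p

∣++∩++∣ : ∀ {c} (s t : Subset j) (p q : Subset m) →
          ∣ s ∩ t ∣ ≡ c → ∣ (s ++ p) ∩ (t ++ q) ∣ ≡ c + ∣ p ∩ q ∣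
∣++∩++∣ s t p q ∣s∩t∣≡c = begin
  ∣ (s ++ p) ∩ (t ++ q) ∣  ≡⟨ cong ∣_∣ (zipWith-++ _∧_ s p t q) ⟩
  ∣ (s ∩ t) ++ (p ∩ q) ∣   ≡⟨ ∣++∣ (s ∩ t) (p ∩ q) ⟩
  ∣ s ∩ t ∣ + ∣ p ∩ q ∣    ≡⟨ cong (_+ ∣ p ∩ q ∣) ∣s∩t∣≡c ⟩
  _ + ∣ p ∩ q ∣            ∎
  where open ≡-Reasoning

∣⊥∩p∣≡0 : (p : Subset n) → ∣ ⊥ ∩ p ∣ ≡ 0
∣⊥∩p∣≡0 {n} p = trans (cong ∣_∣ (∩-zeroˡ p)) (∣⊥∣≡0 n)

∩-full⇒≡ : (p q : Subset n) → ∣ p ∩ q ∣ ≡ ∣ p ∣ → ∣ p ∩ q ∣ ≡ ∣ q ∣ → p ≡ q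
∩-full⇒≡ []          []          _  _  = refl
∩-full⇒≡ (true ∷ p)  (true ∷ q)  ep eq = cong (true ∷_) (∩-full⇒≡ p q (cong pred ep) (cong pred eq))
∩-full⇒≡ (false ∷ p) (false ∷ q) ep eq = cong (false ∷_) (∩-full⇒≡ p q ep eq)
∩-full⇒≡ (true ∷ p)  (false ∷ q) ep _  = ⊥-elim (<-irrefl refl (subst (_≤ ∣ p ∣) ep (∣p∩q∣≤∣p∣ p q)))
∩-full⇒≡ (false ∷ p) (true ∷ q)  _  eq = ⊥-elim (<-irrefl refl (subst (_≤ ∣ q ∣) eq (∣p∩q∣≤∣q∣ p q)))

distinct⇒∣∩∣≢ : ∀ {k} (p q : Subset n) → ∣ p ∣ ≡ k → ∣ q ∣ ≡ k → p ≢ q → ∣ p ∩ q ∣ ≢ k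
distinct⇒∣∩∣≢ p q ∣p∣≡k ∣q∣≡k p≢q ∣p∩q∣≡k =
  p≢q (∩-full⇒≡ p q (trans ∣p∩q∣≡k (≡-sym ∣p∣≡k)) (trans ∣p∩q∣≡k (≡-sym ∣q∣≡k)))

two-points : ∀ {p : Subset n} {x y} → x ∈ p → y ∈ p → x ≢ y → 2 ≤ ∣ p ∣
two-points {p = p} {x} {y} x∈p y∈p x≢y =
  ≤-trans (s≤s (≤-trans (s≤s z≤n) (x∈p⇒∣p-x∣<∣p∣ y∈p-x))) (x∈p⇒∣p-x∣<∣p∣ x∈p)
  where
    -- ∣p - x - y∣ < ∣p - x∣ < ∣p∣, as y ∈ p - x.
    y∈p-x : y ∈ p - x
    y∈p-x = x∈p∧x≢y⇒x∈p-y y∈p (λ y≡x → x≢y (≡-sym y≡x))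

flip-adjacency : ∀ (G : Graph n) {x y} {p q : Subset m} {c} →
                 (T (adj G x y) ⇔ (∣ p ∩ q ∣ ≡ c)) → (T (adj G y x) ⇔ (∣ q ∩ p ∣ ≡ c))
flip-adjacency G {x} {y} {p} {q} h =
  mk⇔ (λ t → trans (cong ∣_∣ (∩-comm q p)) (to h (subst T (sym G y x) t)))
      (λ e → subst T (sym G x y) (from h (trans (cong ∣_∣ (∩-comm p q)) e)))

shift-adjacency : ∀ {A : Set} {a b k} c → b ≡ c + a → (A ⇔ (a ≡ k)) → (A ⇔ (b ≡ c + k))
shift-adjacency c b≡c+a h =
  mk⇔ (λ x → trans b≡c+a (cong (c +_) (to h x)))
      (λ e → from h (+-cancelˡ-≡ c _ _ (trans (≡-sym b≡c+a) e)))

oldTag pendantTag isolatedTag : ∀ j → Subset (3 + j)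
oldTag      _ = true  ∷ true  ∷ false ∷ ⊥
pendantTag  _ = false ∷ true  ∷ true  ∷ ⊥
isolatedTag _ = false ∷ false ∷ false ∷ ⊤

∣oldTag∣ : ∀ j → ∣ oldTag j ∣ ≡ 2
∣oldTag∣ j = cong (2 +_) (∣⊥∣≡0 j)

∣pendantTag∣ : ∀ j → ∣ pendantTag j ∣ ≡ 2
∣pendantTag∣ j = cong (2 +_) (∣⊥∣≡0 j)

∣oldTag∩oldTag∣ : ∀ j → ∣ oldTag j ∩ oldTag j ∣ ≡ 2
∣oldTag∩oldTag∣ j = cong (2 +_) (∣⊥∩p∣≡0 (⊥ {j}))

∣pendantTag∩oldTag∣ : ∀ j → ∣ pendantTag j ∩ oldTag j ∣ ≡ 1
∣pendantTag∩oldTag∣ j = cong suc (∣⊥∩p∣≡0 (⊥ {j}))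

∣isolatedTag∩oldTag∣ : ∀ j → ∣ isolatedTag j ∩ oldTag j ∣ ≡ 0
∣isolatedTag∩oldTag∣ j = trans (cong ∣_∣ (∩-comm (⊤ {j}) ⊥)) (∣⊥∩p∣≡0 (⊤ {j}))

insert : Fin n → (Fin n → Set) → (Fin n → Set)
insert v Q x = Q x ⊎ x ≡ v

data AtMostOneNeighbour (G : Graph n) (Q : Fin n → Set) (v : Fin n) : Set where
  isolated : (∀ u → Q u → ¬ T (adj G v u)) → AtMostOneNeighbour G Q v
  pendant  : ∀ u → Q u → T (adj G v u) → (∀ w → Q w → T (adj G v w) → w ≡ u) →
             AtMostOneNeighbour G Q v

module Extension {G : Graph n} {Q : Fin n → Set} (v : Fin n)
                 {k m} {S : Fin n → Subset m} (rep : Represents G Q (suc k) S) where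

  private
    S-size : ∀ x → Q x → ∣ S x ∣ ≡ suc k
    S-size = proj₁ rep
    S-distinct : ∀ x y → Q x → Q y → x ≢ y → S x ≢ S y
    S-distinct = proj₁ (proj₂ rep)
    S-adjacent : ∀ x y → Q x → Q y → x ≢ y → T (adj G x y) ⇔ (∣ S x ∩ S y ∣ ≡ k)
    S-adjacent = proj₂ (proj₂ rep)

  Tagged : Set
  Tagged = Subset (3 + (3 + k) + m)

  old : Fin n → Tagged
  old x = oldTag (3 + k) ++ S x

  ∣old∣ : ∀ {x} → Q x → ∣ old x ∣ ≡ 3 + k
  ∣old∣ {x} qx = trans (∣++∣ (oldTag (3 + k)) (S x)) (cong₂ _+_ (∣oldTag∣ (3 + k)) (S-size x qx))

  old-adjacent : ∀ x y → Q x → Q y → x ≢ y → T (adj G x y) ⇔ (∣ old x ∩ old y ∣ ≡ 2 + k)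
  old-adjacent x y qx qy x≢y =
    shift-adjacency 2
      (∣++∩++∣ (oldTag (3 + k)) (oldTag (3 + k)) (S x) (S y) (∣oldTag∩oldTag∣ (3 + k)))
      (S-adjacent x y qx qy x≢y)

  record Fits (N : Tagged) : Set where
    field
      size  : ∣ N ∣ ≡ 3 + k
      fresh : ∀ y → Q y → y ≢ v → N ≢ old y
      meets : ∀ y → Q y → y ≢ v → T (adj G v y) ⇔ (∣ N ∩ old y ∣ ≡ 2 + k)

  S′ : Tagged → Fin n → Tagged
  S′ N x with x ≟ v
  ... | yes _ = N
  ... | no  _ = old x

  attach : ∀ {N} → Fits N → JISPred G (insert v Q)
  attach {N} fits = 3 + k , 3 + (3 + k) + m , S′ N , s≤s z≤n , size′ , distinct′ , adjacent′
    where
      open Fits fits renaming (size to ∣N∣)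

      old-vertex : ∀ {x} → insert v Q x → x ≢ v → Q x
      old-vertex (inj₁ qx)  _   = qx
      old-vertex (inj₂ x≡v) x≢v = ⊥-elim (x≢v x≡v)

      size′ : ∀ x → insert v Q x → ∣ S′ N x ∣ ≡ 3 + k
      size′ x qx with x ≟ v
      ... | yes _   = ∣N∣
      ... | no  x≢v = ∣old∣ (old-vertex qx x≢v)

      distinct′ : ∀ x y → insert v Q x → insert v Q y → x ≢ y → S′ N x ≢ S′ N y
      distinct′ x y qx qy x≢y with x ≟ v | y ≟ v
      ... | yes refl | yes refl = ⊥-elim (x≢y refl)
      ... | yes refl | no  y≢v  = fresh y (old-vertex qy y≢v) y≢v
      ... | no  x≢v  | yes refl = λ e → fresh x (old-vertex qx x≢v) x≢v (≡-sym e)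
      ... | no  x≢v  | no  y≢v  =
        λ e → S-distinct x y (old-vertex qx x≢v) (old-vertex qy y≢v) x≢y
                (++-injectiveʳ (oldTag (3 + k)) (oldTag (3 + k)) e)

      adjacent′ : ∀ x y → insert v Q x → insert v Q y → x ≢ y →
                  T (adj G x y) ⇔ (∣ S′ N x ∩ S′ N y ∣ ≡ 2 + k)
      adjacent′ x y qx qy x≢y with x ≟ v | y ≟ v
      ... | yes refl | yes refl = ⊥-elim (x≢y refl)
      ... | yes refl | no  y≢v  = meets y (old-vertex qy y≢v) y≢v
      ... | no  x≢v  | yes refl = flip-adjacency G {p = N} (meets x (old-vertex qx x≢v) x≢v)
      ... | no  x≢v  | no  y≢v  = old-adjacent x y (old-vertex qx x≢v) (old-vertex qy y≢v) x≢y

  -- A pendant vertex copies the set of its neighbour u under the shifted tag: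
  -- it meets the new set of u in all but one point, and any other old set,
  -- being distinct from S u, in fewer.
  pendant-fits : ∀ {u} → Q u → T (adj G v u) → (∀ w → Q w → T (adj G v w) → w ≡ u) →
                 Fits (pendantTag (3 + k) ++ S u)
  pendant-fits {u} qu vu unique = record
    { size  = trans (∣++∣ (pendantTag (3 + k)) (S u)) (cong₂ _+_ (∣pendantTag∣ (3 + k)) (S-size u qu))
    ; fresh = λ _ _ _ ()
    ; meets = meets
    }
    where
      ∣N∩old∣ : ∀ y → ∣ (pendantTag (3 + k) ++ S u) ∩ old y ∣ ≡ 1 + ∣ S u ∩ S y ∣
      ∣N∩old∣ y = ∣++∩++∣ (pendantTag (3 + k)) (oldTag (3 + k)) (S u) (S y) (∣pendantTag∩oldTag∣ (3 + k))

      meets : ∀ y → Q y → y ≢ v → T (adj G v y) ⇔ (∣ (pendantTag (3 + k) ++ S u) ∩ old y ∣ ≡ 2 + k)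
      meets y qy _ with y ≟ u
      ... | yes refl =
        mk⇔ (λ _ → trans (∣N∩old∣ u) (cong suc (trans (cong ∣_∣ (∩-idem (S u))) (S-size u qu))))
            (λ _ → vu)
      ... | no  y≢u  =
        mk⇔ (λ vy → ⊥-elim (y≢u (unique y qy vy)))
            (λ e → ⊥-elim (distinct⇒∣∩∣≢ (S u) (S y) (S-size u qu) (S-size y qy)
                             (S-distinct u y qu qy (λ u≡y → y≢u (≡-sym u≡y)))
                             (cong pred (trans (≡-sym (∣N∩old∣ y)) e))))

  isolated-fits : (∀ u → Q u → ¬ T (adj G v u)) → Fits (isolatedTag (3 + k) ++ ⊥)
  isolated-fits none = record
    { size  = trans (∣++∣ (isolatedTag (3 + k)) ⊥)
                    (trans (cong₂ _+_ (∣⊤∣≡n (3 + k)) (∣⊥∣≡0 m)) (+-identityʳ _))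
    ; fresh = λ _ _ _ ()
    ; meets = λ y qy _ → mk⇔ (λ vy → ⊥-elim (none y qy vy))
                             (λ e → ⊥-elim (0≢1+n (trans (≡-sym (∣N∩old∣ y)) e)))
    }
    where
      ∣N∩old∣ : ∀ y → ∣ (isolatedTag (3 + k) ++ ⊥) ∩ old y ∣ ≡ 0
      ∣N∩old∣ y = trans (∣++∩++∣ (isolatedTag (3 + k)) (oldTag (3 + k)) ⊥ (S y) (∣isolatedTag∩oldTag∣ (3 + k)))
                        (∣⊥∩p∣≡0 (S y))

extend : ∀ (G : Graph n) {Q : Fin n → Set} {v} →
         AtMostOneNeighbour G Q v → JISPred G Q → JISPred G (insert v Q)
extend _ _ (zero , _ , _ , () , _)
extend G {Q} {v} (isolated none) (suc _ , _ , _ , _ , rep) =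
  attach (isolated-fits none)
  where open Extension {G = G} {Q} v rep
extend G {Q} {v} (pendant _ qu vu unique) (suc _ , _ , _ , _ , rep) =
  attach (pendant-fits qu vu unique)
  where open Extension {G = G} {Q} v rep

∈-tabulate⁺ : ∀ (f : Fin n → Bool) {x} → T (f x) → x ∈ tabulate f
∈-tabulate⁺ f {x} t = lookup⇒[]= x (tabulate f) (trans (lookup∘tabulate f x) (to T-≡ t))

∈-tabulate⁻ : ∀ (f : Fin n → Bool) {x} → x ∈ tabulate f → T (f x)
∈-tabulate⁻ f {x} x∈ = from T-≡ (trans (≡-sym (lookup∘tabulate f x)) ([]=⇒lookup x∈))

low-degree⇒at-most-one : ∀ {G : Graph n} {P : Subset n} {Q : Fin n → Set} {v} →
                         Decidable Q → (∀ {x} → Q x → x ∈ P) → ¬ (2 ≤ degIn G P v) →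
                         AtMostOneNeighbour G Q v
low-degree⇒at-most-one {G = G} {P} {Q} {v} Q? Q⊆P low
  with any? (λ u → Q? u ×-dec T? (adj G v u))
... | no  none           = isolated (λ u qu vu → none (u , qu , vu))
... | yes (u , qu , vu)  = pendant u qu vu unique
  where
    neighbour-in-P : ∀ {w} → Q w → T (adj G v w) → w ∈ P ∩ nbhd G v
    neighbour-in-P qw vw = x∈p∩q⁺ (Q⊆P qw , ∈-tabulate⁺ (adj G v) vw)

    unique : ∀ w → Q w → T (adj G v w) → w ≡ u
    unique w qw vw = decidable-stable (w ≟ u)
      (λ w≢u → low (two-points (neighbour-in-P qw vw) (neighbour-in-P qu vu) w≢u))

module Reinsertion (G : Graph n) {P : Subset n} {Q : Fin n → Set} (Q? : Decidable Q)
                   (Q⊆P : ∀ {x} → Q x → x ∈ P)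
                   (low : ∀ {x} → x ∈ P → ¬ Q x → ¬ (2 ≤ degIn G P x)) where

  open import Data.List.Membership.DecPropositional (_≟_ {n}) using () renaming (_∈?_ to _∈ₗ?_)

  Q+ : List (Fin n) → Fin n → Set
  Q+ l x = Q x ⊎ (x ∈ P × x ∈ₗ l)

  Q+? : ∀ l → Decidable (Q+ l)
  Q+? l x = Q? x ⊎-dec (x ∈? P ×-dec x ∈ₗ? l)

  Q+⊆P : ∀ {l x} → Q+ l x → x ∈ P
  Q+⊆P (inj₁ qx)      = Q⊆P qx
  Q+⊆P (inj₂ (x∈P , _)) = x∈P

  skip : ∀ {v l} → (v ∈ P → Q v) → ∀ {x} → Q+ (v ∷ l) x → Q+ l x
  skip _   (inj₁ qx)                  = inj₁ qx
  skip v∈Q (inj₂ (x∈P , here refl))   = inj₁ (v∈Q x∈P)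
  skip _   (inj₂ (x∈P , there x∈l))   = inj₂ (x∈P , x∈l)

  Q+-cons : ∀ {v l x} → Q+ (v ∷ l) x → insert v (Q+ l) x
  Q+-cons (inj₁ qx)                = inj₁ (inj₁ qx)
  Q+-cons (inj₂ (_ , here refl))   = inj₂ refl
  Q+-cons (inj₂ (x∈P , there x∈l)) = inj₁ (inj₂ (x∈P , x∈l))

  reinsert-list : ∀ l → JISPred G Q → JISPred G (Q+ l)
  reinsert-list []      h = JISPred-mono G (λ { (inj₁ qx) → qx ; (inj₂ (_ , ())) }) h
  reinsert-list (v ∷ l) h with Q? v | v ∈? P
  ... | yes qv | _       = JISPred-mono G (skip (λ _ → qv)) (reinsert-list l h)
  ... | no  _  | no v∉P  = JISPred-mono G (skip (λ v∈P → ⊥-elim (v∉P v∈P))) (reinsert-list l h)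
  ... | no ¬qv | yes v∈P =
    JISPred-mono G Q+-cons
      (extend G (low-degree⇒at-most-one (Q+? l) Q+⊆P (low v∈P ¬qv)) (reinsert-list l h))

  reinsert : JISPred G Q → JISPred G (_∈ P)
  reinsert h = JISPred-mono G (λ {x} x∈P → inj₂ (x∈P , ∈-allFin x)) (reinsert-list (allFin n) h)

peel⊆ : ∀ (G : Graph n) {P x} → x ∈ peel G P → x ∈ P
peel⊆ _ {P} {x} x∈ = lookup⇒[]= x P (to T-≡ (proj₁ (to T-∧ (∈-tabulate⁻ _ x∈))))

2≤deg⇒∈peel : ∀ (G : Graph n) {P x} → x ∈ P → 2 ≤ degIn G P x → x ∈ peel G P
2≤deg⇒∈peel _ x∈P 2≤deg = ∈-tabulate⁺ _ (from T-∧ (from T-≡ ([]=⇒lookup x∈P) , ≤⇒≤ᵇ 2≤deg))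

unpeel : ∀ (G : Graph n) {P} → JISOn G (peel G P) → JISOn G P
unpeel G {P} = reinsert
  where open Reinsertion G {P} (_∈? peel G P) (peel⊆ G)
                         (λ x∈P x∉peel 2≤deg → x∉peel (2≤deg⇒∈peel G x∈P 2≤deg))

unpeel-rounds : ∀ (G : Graph n) i → JISOn G (iter i (peel G) ⊤) → JIS G
unpeel-rounds G zero    h = h
unpeel-rounds G (suc i) h = unpeel-rounds G i (unpeel G h)

proposition5 : ∀ (n : ℕ) (G : Graph n) → JIS G ⇔ CoreJIS G
proposition5 n G = mk⇔ (JISPred-mono G (λ _ → ∈⊤)) (unpeel-rounds G n)
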